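{- Let $n\ge 1$ and let $G$ be a graph on $n$ vertices that maximizes $\partial(G)+\partial(\bar{G})$ among all graphs on $n$ vertices. Then $\min\{\delta(G),\delta(\bar{G})\}\ge \lfloor n/2\rfloor-2$ and $\max\{\Delta(G),\Delta(\bar{G})\}\le \lceil n/2\rceil+1$.
   Context: A dominating set in a graph $G$ is a set $S$ of vertices such that every vertex of $G$ is either in $S$ or adjacent to a vertex of $S$. $\partial(G)$ denotes the number of dominating sets of $G$, and $\bar{G}$ denotes the complement of $G$. $\delta(\cdot)$ and $\Delta(\cdot)$ denote minimum and maximum degree. Graphs are finite and simple. -}

module Defs where

open import Data.Nat using (ℕ; zero; suc; _+_; _∸_; _⊔_; _⊓_)
open import Data.Bool using (Bool; true; false; _∧_; _∨_; not; T)
open import Data.Fin using (Fin)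
open import Data.List using (List; []; _∷_; map; length; filterᵇ; allFin; _++_; foldr)
open import Data.Vec using (Vec; []; _∷_; lookup)
open import Relation.Binary.PropositionalEquality using (_≡_; refl; cong₂)
open import Relation.Nullary using (yes; no)
open import Relation.Nullary.Decidable using (⌊_⌋)
open import Data.Empty using (⊥-elim)
open import Data.Bool.Properties using (∧-zeroʳ)
import Data.Fin as F
open import Data.Bool.ListAction using (all; any)

record Graph (n : ℕ) : Set where
  field
    adj   : Fin n → Fin n → Bool
    sym   : ∀ u v → adj u v ≡ adj v u
    irrefl : ∀ v → adj v v ≡ false
open Graph public

complement : ∀ {n} → Graph n → Graph n
complement {n} G = record
  { adj = λ u v → not (adj G u v) ∧ not (eqᵇ u v)
  ; sym = λ u v → symC u v
  ; irrefl = λ v → irrC v }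
  where
    open F using (_≟_)
    eqᵇ : Fin n → Fin n → Bool
    eqᵇ u v = ⌊ u ≟ v ⌋
    eq-sym : ∀ u v → eqᵇ u v ≡ eqᵇ v u
    eq-sym u v with u ≟ v | v ≟ u
    ... | yes _ | yes _ = refl
    ... | no _  | no _  = refl
    ... | yes refl | no ¬p = ⊥-elim (¬p refl)
    ... | no ¬p | yes refl = ⊥-elim (¬p refl)
    symC : ∀ u v → (not (adj G u v) ∧ not (eqᵇ u v)) ≡ (not (adj G v u) ∧ not (eqᵇ v u))
    symC u v = cong₂ (λ a b → not a ∧ not b) (sym G u v) (eq-sym u v)
    irrC : ∀ v → (not (adj G v v) ∧ not (eqᵇ v v)) ≡ false
    irrC v with v ≟ v
    ... | yes _ = ∧-zeroʳ (not (adj G v v))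
    ... | no ¬p = ⊥-elim (¬p refl)

-- All subsets of Fin n, as characteristic vectors (each exactly once).
subsets : (n : ℕ) → List (Vec Bool n)
subsets zero = [] ∷ []
subsets (suc n) = map (false ∷_) (subsets n) ++ map (true ∷_) (subsets n)

isDominatingᵇ : ∀ {n} → Graph n → Vec Bool n → Bool
isDominatingᵇ {n} G S =
  all (λ v → lookup S v ∨ any (λ u → lookup S u ∧ adj G v u) (allFin n)) (allFin n)

∂ : ∀ {n} → Graph n → ℕ
∂ {n} G = length (filterᵇ (isDominatingᵇ G) (subsets n))

deg : ∀ {n} → Graph n → Fin n → ℕ
deg {n} G v = length (filterᵇ (adj G v) (allFin n))

-- minimum / maximum degree (for n ≥ 1; the fold seeds are harmless there)
δ : ∀ {n} → Graph (suc n) → ℕ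
δ {n} G = foldr (λ v m → deg G v ⊓ m) (deg G F.zero) (allFin (suc n))

Δ : ∀ {n} → Graph n → ℕ
Δ {n} G = foldr (λ v m → deg G v ⊔ m) 0 (allFin n)

-- If v has degree d in G, none of the 2^d subsets of its G-neighbourhood dominates v in the
-- complement, so ∂ Ḡ ≤ 2^N − 2^d; with ∂ G ≤ 2^N this gives ∂ G + ∂ Ḡ ≤ 2^(N+1) − 2^d.
-- For the balanced complete bipartite graph H = K_{⌊N/2⌋,⌈N/2⌉}, every vertex set meeting both
-- sides dominates both H and Ḣ (two disjoint cliques), so
-- ∂ H + ∂ Ḣ ≥ 2 (2^N − 2^⌊N/2⌋ − 2^⌈N/2⌉ + 1) > 2^(N+1) − 2^(⌈N/2⌉+2).
-- Maximality of G therefore forces d ≤ ⌈N/2⌉ + 1, in G and in Ḡ alike, and the bound on the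
-- minimum degree follows because the degrees of v in G and in Ḡ add up to N − 1.

module Submission where

open import Defs hiding (sym)
open import Data.Product using (_×_; _,_; proj₁; proj₂; ∃-syntax)
open import Data.Sum using (_⊎_; inj₁; inj₂)
open import Data.Nat using (ℕ; zero; suc; _+_; _∸_; _≤_; _<_; _⊓_; _⊔_; ⌊_/2⌋; ⌈_/2⌉; _^_; z≤n; s≤s; s≤s⁻¹; _<ᵇ_)
open import Data.Nat.Properties
  using (+-suc; +-assoc; +-comm; +-identityʳ; +-monoʳ-≤; +-monoˡ-≤; +-mono-≤; +-cancelˡ-≡; +-cancelˡ-≤; +-cancelʳ-≤;
         ≤-antisym; m≤n⇒m≤1+n; <-≤-trans; m<m+n; ≰⇒>; <⇒≱; m≤n+o⇒m∸n≤o; ^-monoʳ-≤; ⊓-glb; ⊔-lub; m≥n⇒m⊓n≡n;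
         ⌊n/2⌋≤n; ⌊n/2⌋≤⌈n/2⌉; ⌊n/2⌋+⌈n/2⌉≡n; module ≤-Reasoning)
open import Data.Bool using (Bool; true; false; _∧_; _∨_; not; _xor_; if_then_else_; T; T?)
open import Data.Bool.Properties using (T-∧; T-∨; ∧-identityʳ; ∧-zeroʳ; ∧-inverseˡ; not-injective; xor-comm; xor-same; not-distribʳ-xor)
open import Data.Fin using (Fin; zero; suc; toℕ; _≟_)
open import Data.List using (List; []; _∷_; map; length; filterᵇ; allFin; _++_; foldr; tabulate)
open import Data.List.Properties using (length-++; length-map; length-filter; filter-++)
open import Data.List.Relation.Unary.All as All using ()
open import Data.List.Relation.Unary.All.Properties using (all⁺; all⁻)
open import Data.List.Relation.Unary.Any using (satisfied)
open import Data.List.Relation.Unary.Any.Properties using (any⁺; any⁻)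
open import Data.List.Membership.Propositional using (lose)
open import Data.List.Membership.Propositional.Properties using (∈-allFin)
open import Data.Vec using (Vec; []; _∷_; lookup)
open import Data.Bool.ListAction using (any)
open import Data.Empty using (⊥-elim)
open import Function using (_∘_; case_of_; Equivalence)
open import Relation.Binary.PropositionalEquality
open import Relation.Nullary using (¬_; yes; no; does)
open import Relation.Nullary.Decidable using (isYes≗does; dec-false)
open import Data.Nat.Solver using (module +-*-Solver)

open Equivalence using (to; from)

private
  variable
    A B : Set
    N : ℕ

¬T⇒T-not : ∀ {b} → ¬ T b → T (not b)
¬T⇒T-not {false} _  = _
¬T⇒T-not {true}  ¬t = ⊥-elim (¬t _)

count : (A → Bool) → List A → ℕ
count p xs = length (filterᵇ p xs)

count-++ : (p : A → Bool) (xs ys : List A) → count p (xs ++ ys) ≡ count p xs + count p ys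
count-++ p xs ys = trans (cong length (filter-++ (T? ∘ p) xs ys)) (length-++ (filterᵇ p xs))

count-map : (p : B → Bool) (f : A → B) (xs : List A) → count p (map f xs) ≡ count (p ∘ f) xs
count-map p f []       = refl
count-map p f (x ∷ xs) with p (f x)
... | true  = cong suc (count-map p f xs)
... | false = count-map p f xs

count-mono : (p q : A → Bool) → (∀ x → T (p x) → T (q x)) → ∀ xs → count p xs ≤ count q xs
count-mono p q p⇒q []       = z≤n
count-mono p q p⇒q (x ∷ xs) with p x | q x | p⇒q x
... | true  | true  | _   = s≤s (count-mono p q p⇒q xs)
... | true  | false | p⇒f = ⊥-elim (p⇒f _)
... | false | true  | _   = m≤n⇒m≤1+n (count-mono p q p⇒q xs)
... | false | false | _   = count-mono p q p⇒q xs

count-cong : (p q : A → Bool) → (∀ x → p x ≡ q x) → ∀ xs → count p xs ≡ count q xs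
count-cong p q p≗q xs = ≤-antisym (count-mono p q (λ x → subst T (p≗q x)) xs)
                                  (count-mono q p (λ x → subst T (sym (p≗q x))) xs)

count-+-count-not : (p : A → Bool) (xs : List A) → count p xs + count (not ∘ p) xs ≡ length xs
count-+-count-not p []       = refl
count-+-count-not p (x ∷ xs) with p x
... | true  = cong suc (count-+-count-not p xs)
... | false = trans (+-suc _ _) (cong suc (count-+-count-not p xs))

count-∨-+-count-∧ : (p q : A → Bool) (xs : List A) →
  count (λ x → p x ∨ q x) xs + count (λ x → p x ∧ q x) xs ≡ count p xs + count q xs
count-∨-+-count-∧ p q []       = refl
count-∨-+-count-∧ p q (x ∷ xs) with p x | q x
... | true  | true  = cong suc (trans (+-suc _ _) (trans (cong suc (count-∨-+-count-∧ p q xs)) (sym (+-suc _ _))))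
... | true  | false = cong suc (count-∨-+-count-∧ p q xs)
... | false | true  = trans (cong suc (count-∨-+-count-∧ p q xs)) (sym (+-suc _ _))
... | false | false = count-∨-+-count-∧ p q xs

∣_∣ : (Fin N → Bool) → ℕ
∣_∣ {zero}  p = 0
∣_∣ {suc N} p = (if p zero then 1 else 0) + ∣ p ∘ suc ∣

∣∣-cong : (p q : Fin N → Bool) → (∀ u → p u ≡ q u) → ∣ p ∣ ≡ ∣ q ∣
∣∣-cong {zero}  p q p≗q = refl
∣∣-cong {suc N} p q p≗q = cong₂ _+_ (cong (if_then 1 else 0) (p≗q zero)) (∣∣-cong (p ∘ suc) (q ∘ suc) (p≗q ∘ suc))

count-tabulate : (p : A → Bool) (f : Fin N → A) → count p (tabulate f) ≡ ∣ p ∘ f ∣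
count-tabulate {N = zero}  p f = refl
count-tabulate {N = suc N} p f with p (f zero)
... | true  = cong suc (count-tabulate p (f ∘ suc))
... | false = count-tabulate p (f ∘ suc)

∣∣-+-∣not∣ : (p : Fin N → Bool) → ∣ p ∣ + ∣ not ∘ p ∣ ≡ N
∣∣-+-∣not∣ {zero}  p = refl
∣∣-+-∣not∣ {suc N} p with p zero
... | true  = cong suc (∣∣-+-∣not∣ (p ∘ suc))
... | false = trans (+-suc _ _) (cong suc (∣∣-+-∣not∣ (p ∘ suc)))

∣∣-none : (p : Fin N → Bool) → (∀ u → p u ≡ false) → ∣ p ∣ ≡ 0
∣∣-none {zero}  p none = refl
∣∣-none {suc N} p none rewrite none zero = ∣∣-none (p ∘ suc) (none ∘ suc)

∣<ᵇ∣ : ∀ N k → ∣ (λ (u : Fin N) → toℕ u <ᵇ k) ∣ ≡ N ⊓ k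
∣<ᵇ∣ zero    k       = refl
∣<ᵇ∣ (suc N) zero    = ∣∣-none {N} _ (λ _ → refl)
∣<ᵇ∣ (suc N) (suc k) = cong suc (∣<ᵇ∣ N k)

∣∣-+-∣not-except∣ : ∀ {n} (p : Fin (suc n) → Bool) v → p v ≡ false →
  ∣ p ∣ + ∣ (λ u → not (p u) ∧ not (does (v ≟ u))) ∣ ≡ n
∣∣-+-∣not-except∣ p zero pv rewrite pv =
  trans (cong (∣ p ∘ suc ∣ +_) (∣∣-cong _ (not ∘ p ∘ suc) (λ _ → ∧-identityʳ _))) (∣∣-+-∣not∣ (p ∘ suc))
∣∣-+-∣not-except∣ {suc n} p (suc w) pv with p zero
... | true  = cong suc (∣∣-+-∣not-except∣ (p ∘ suc) w pv)
... | false = trans (+-suc _ _) (cong suc (∣∣-+-∣not-except∣ (p ∘ suc) w pv))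

length-subsets : ∀ N → length (subsets N) ≡ 2 ^ N
length-subsets zero    = refl
length-subsets (suc N) = begin
  length (map (false ∷_) (subsets N) ++ map (true ∷_) (subsets N))
    ≡⟨ length-++ (map (false ∷_) (subsets N)) ⟩
  length (map (false ∷_) (subsets N)) + length (map (true ∷_) (subsets N))
    ≡⟨ cong₂ _+_ (length-map _ (subsets N)) (length-map _ (subsets N)) ⟩
  length (subsets N) + length (subsets N)
    ≡⟨ cong₂ _+_ (length-subsets N) (trans (length-subsets N) (sym (+-identityʳ _))) ⟩
  2 ^ suc N ∎
  where open ≡-Reasoning

count-subsets-suc : (P : Vec Bool (suc N) → Bool) →
  count P (subsets (suc N)) ≡ count (P ∘ (false ∷_)) (subsets N) + count (P ∘ (true ∷_)) (subsets N)
count-subsets-suc {N} P =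
  trans (count-++ P (map (false ∷_) (subsets N)) (map (true ∷_) (subsets N)))
        (cong₂ _+_ (count-map P _ (subsets N)) (count-map P _ (subsets N)))

_⊆ᵇ_ : Vec Bool N → (Fin N → Bool) → Bool
[]      ⊆ᵇ p = true
(x ∷ S) ⊆ᵇ p = (not x ∨ p zero) ∧ (S ⊆ᵇ (p ∘ suc))

count-⊆ᵇ : (p : Fin N → Bool) → count (_⊆ᵇ p) (subsets N) ≡ 2 ^ ∣ p ∣
count-⊆ᵇ {zero}  p = refl
count-⊆ᵇ {suc N} p = trans (count-subsets-suc (_⊆ᵇ p)) (split (p zero))
  where
  split : ∀ b → count (_⊆ᵇ (p ∘ suc)) (subsets N) + count (λ S → b ∧ (S ⊆ᵇ (p ∘ suc))) (subsets N)
                ≡ 2 ^ ((if b then 1 else 0) + ∣ p ∘ suc ∣)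
  split true  = cong₂ _+_ (count-⊆ᵇ (p ∘ suc)) (trans (count-⊆ᵇ (p ∘ suc)) (sym (+-identityʳ _)))
  split false = trans (cong₂ _+_ (count-⊆ᵇ (p ∘ suc)) (count-none (subsets N))) (+-identityʳ _)
    where
    count-none : (xs : List A) → count (λ _ → false) xs ≡ 0
    count-none []       = refl
    count-none (_ ∷ xs) = count-none xs

⊆ᵇ-∧ : (S : Vec Bool N) (p q : Fin N → Bool) → (S ⊆ᵇ p) ∧ (S ⊆ᵇ q) ≡ S ⊆ᵇ (λ u → p u ∧ q u)
⊆ᵇ-∧ []          p q = refl
⊆ᵇ-∧ (false ∷ S) p q = ⊆ᵇ-∧ S (p ∘ suc) (q ∘ suc)
⊆ᵇ-∧ (true ∷ S)  p q with p zero | q zero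
... | true  | true  = ⊆ᵇ-∧ S (p ∘ suc) (q ∘ suc)
... | true  | false = ∧-zeroʳ _
... | false | _     = refl

⊆ᵇ-sound : ∀ (S : Vec Bool N) p u → T (S ⊆ᵇ p) → T (lookup S u) → T (p u)
⊆ᵇ-sound (true ∷ S) p zero    S⊆p _  = (T-∧ .to S⊆p) .proj₁
⊆ᵇ-sound (x ∷ S)    p (suc u) S⊆p Su = ⊆ᵇ-sound S (p ∘ suc) u ((T-∧ .to S⊆p) .proj₂) Su

⊆ᵇ-witness : ∀ (S : Vec Bool N) p → S ⊆ᵇ p ≡ false → ∃[ u ] T (lookup S u) × p u ≡ false
⊆ᵇ-witness (x ∷ S) p S⊈p with x | p zero in p0
... | true  | false = zero , _ , p0
... | true  | true  with (u , Su , pu) ← ⊆ᵇ-witness S (p ∘ suc) S⊈p = suc u , Su , pu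
... | false | _     with (u , Su , pu) ← ⊆ᵇ-witness S (p ∘ suc) S⊈p = suc u , Su , pu

Dominated : Graph N → Vec Bool N → Fin N → Set
Dominated G S v = T (lookup S v) ⊎ ∃[ u ] T (lookup S u) × T (adj G v u)

isDominatingᵇ-sound : (G : Graph N) (S : Vec Bool N) → T (isDominatingᵇ G S) → ∀ v → Dominated G S v
isDominatingᵇ-sound {N} G S dom v with T-∨ .to (All.lookup (all⁺ _ (allFin N) dom) (∈-allFin v))
... | inj₁ Sv  = inj₁ Sv
... | inj₂ Sadj with (u , Su∧vu) ← satisfied (any⁻ _ (allFin N) Sadj) = inj₂ (u , T-∧ .to Su∧vu)

isDominatingᵇ-complete : (G : Graph N) (S : Vec Bool N) → (∀ v → Dominated G S v) → T (isDominatingᵇ G S)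
isDominatingᵇ-complete {N} G S dom = all⁻ _ {xs = allFin N} (All.tabulate (λ {v} _ → T-∨ .from (dominated v)))
  where
  dominated : ∀ v → T (lookup S v) ⊎ T (any (λ u → lookup S u ∧ adj G v u) (allFin N))
  dominated v with dom v
  ... | inj₁ Sv             = inj₁ Sv
  ... | inj₂ (u , Su , vu) = inj₂ (any⁺ _ (lose (∈-allFin u) (T-∧ .from (Su , vu))))

∂≤2^N : (G : Graph N) → ∂ G ≤ 2 ^ N
∂≤2^N {N} G = subst (∂ G ≤_) (length-subsets N) (length-filter _ (subsets N))

-- None of the 2^∣p∣ subsets of p dominates v.
∂+2^∣p∣≤2^N : (G : Graph N) (v : Fin N) (p : Fin N → Bool) → ¬ T (p v) →
  (∀ u → T (p u) → ¬ T (adj G v u)) → ∂ G + 2 ^ ∣ p ∣ ≤ 2 ^ N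
∂+2^∣p∣≤2^N {N} G v p ¬pv ¬vp = begin
  ∂ G + 2 ^ ∣ p ∣                                 ≡⟨ cong (∂ G +_) (count-⊆ᵇ p) ⟨
  ∂ G + count (_⊆ᵇ p) (subsets N)                  ≤⟨ +-monoʳ-≤ (∂ G) (count-mono _ _ nondominating (subsets N)) ⟩
  ∂ G + count (not ∘ isDominatingᵇ G) (subsets N) ≡⟨ count-+-count-not (isDominatingᵇ G) (subsets N) ⟩
  length (subsets N)                               ≡⟨ length-subsets N ⟩
  2 ^ N                                            ∎
  where
  open ≤-Reasoning
  nondominating : ∀ S → T (S ⊆ᵇ p) → T (not (isDominatingᵇ G S))
  nondominating S S⊆p = ¬T⇒T-not λ dom → case isDominatingᵇ-sound G S dom v of λ where
    (inj₁ Sv)            → ¬pv (⊆ᵇ-sound S p v S⊆p Sv)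
    (inj₂ (u , Su , vu)) → ¬vp u (⊆ᵇ-sound S p u S⊆p Su) vu

deg≡∣adj∣ : (G : Graph N) (v : Fin N) → deg G v ≡ ∣ adj G v ∣
deg≡∣adj∣ G v = count-tabulate (adj G v) (λ u → u)

∂̄+2^deg≤2^N : (G : Graph N) (v : Fin N) → ∂ (complement G) + 2 ^ deg G v ≤ 2 ^ N
∂̄+2^deg≤2^N G v rewrite deg≡∣adj∣ G v =
  ∂+2^∣p∣≤2^N (complement G) v (adj G v) (subst T (irrefl G v)) non-adjacent
  where
  non-adjacent : ∀ u → T (adj G v u) → ¬ T (adj (complement G) v u)
  non-adjacent u vu with adj G v u
  ... | true = λ ()

∂+2^deḡ≤2^N : (G : Graph N) (v : Fin N) → ∂ G + 2 ^ deg (complement G) v ≤ 2 ^ N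
∂+2^deḡ≤2^N G v rewrite deg≡∣adj∣ (complement G) v =
  ∂+2^∣p∣≤2^N G v (adj (complement G) v) (subst T (irrefl (complement G) v)) non-adjacent
  where
  non-adjacent : ∀ u → T (adj (complement G) v u) → ¬ T (adj G v u)
  non-adjacent u v̄u with adj G v u
  ... | false = λ ()

deg+deḡ≡n : ∀ {n} (G : Graph (suc n)) v → deg G v + deg (complement G) v ≡ n
deg+deḡ≡n {n} G v = begin
  deg G v + deg (complement G) v
    ≡⟨ cong₂ _+_ (deg≡∣adj∣ G v) (deg≡∣adj∣ (complement G) v) ⟩
  ∣ adj G v ∣ + ∣ adj (complement G) v ∣
    ≡⟨ cong (∣ adj G v ∣ +_) (∣∣-cong _ _ (λ u → cong (λ b → not (adj G v u) ∧ not b) (isYes≗does (v ≟ u)))) ⟩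
  ∣ adj G v ∣ + ∣ (λ u → not (adj G v u) ∧ not (does (v ≟ u))) ∣
    ≡⟨ ∣∣-+-∣not-except∣ (adj G v) v (irrefl G v) ⟩
  n ∎
  where open ≡-Reasoning

bipartite : (Fin N → Bool) → Graph N
bipartite s = record
  { adj    = λ u v → s u xor s v
  ; sym    = λ u v → xor-comm (s u) (s v)
  ; irrefl = λ v → xor-same (s v)
  }

meetsBoth : (Fin N → Bool) → Vec Bool N → Bool
meetsBoth s S = not ((S ⊆ᵇ (not ∘ s)) ∨ (S ⊆ᵇ s))

meetsBoth-side : ∀ (s : Fin N → Bool) S → T (meetsBoth s S) → ∀ b → ∃[ u ] T (lookup S u) × s u ≡ b
meetsBoth-side s S meets b with S ⊆ᵇ (not ∘ s) in S⊆s̄ | S ⊆ᵇ s in S⊆s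
meetsBoth-side s S meets true  | false | false with (u , Su , s̄u) ← ⊆ᵇ-witness S (not ∘ s) S⊆s̄ =
  u , Su , not-injective s̄u
meetsBoth-side s S meets false | false | false = ⊆ᵇ-witness S s S⊆s

meetsBoth⇒dominates-bipartite : ∀ (s : Fin N → Bool) S → T (meetsBoth s S) → T (isDominatingᵇ (bipartite s) S)
meetsBoth⇒dominates-bipartite s S meets = isDominatingᵇ-complete (bipartite s) S λ v →
  let (u , Su , su) = meetsBoth-side s S meets (not (s v)) in
  inj₂ (u , Su , subst T (sym (cross-edge (s v) (s u) su)) _)
  where
  cross-edge : ∀ a b → b ≡ not a → a xor b ≡ true
  cross-edge a .(not a) refl = trans (sym (not-distribʳ-xor a a)) (cong not (xor-same a))

meetsBoth⇒dominates-complement : ∀ (s : Fin N → Bool) S → T (meetsBoth s S) →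
  T (isDominatingᵇ (complement (bipartite s)) S)
meetsBoth⇒dominates-complement s S meets = isDominatingᵇ-complete (complement (bipartite s)) S λ v →
  dominated v (meetsBoth-side s S meets (s v))
  where
  dominated : ∀ v → ∃[ u ] T (lookup S u) × s u ≡ s v → Dominated (complement (bipartite s)) S v
  dominated v (u , Su , su) with v ≟ u
  ... | yes refl = inj₁ Su
  ... | no v≢u   = inj₂ (u , Su , subst T (sym (cong₂ (λ a b → not a ∧ not b)
                     (trans (cong (s v xor_) su) (xor-same (s v)))
                     (trans (isYes≗does (v ≟ u)) (dec-false (v ≟ u) v≢u)))) _)

count-meetsBoth : (s : Fin N → Bool) →
  count (meetsBoth s) (subsets N) + 2 ^ ∣ not ∘ s ∣ + 2 ^ ∣ s ∣ ≡ 2 ^ N + 1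
count-meetsBoth {N} s = begin
  M + 2 ^ ∣ not ∘ s ∣ + 2 ^ ∣ s ∣ ≡⟨ +-assoc M _ _ ⟩
  M + (2 ^ ∣ not ∘ s ∣ + 2 ^ ∣ s ∣) ≡⟨ cong (M +_) (cong₂ _+_ (count-⊆ᵇ (not ∘ s)) (count-⊆ᵇ s)) ⟨
  M + (count ⊆s̄ (subsets N) + count ⊆s (subsets N)) ≡⟨ cong (M +_) (count-∨-+-count-∧ ⊆s̄ ⊆s (subsets N)) ⟨
  M + (count ⊆s̄∨⊆s (subsets N) + count ⊆s̄∧⊆s (subsets N)) ≡⟨ cong (λ k → M + (count ⊆s̄∨⊆s (subsets N) + k)) only-∅ ⟩
  M + (count ⊆s̄∨⊆s (subsets N) + 1) ≡⟨ +-assoc M _ 1 ⟨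
  M + count ⊆s̄∨⊆s (subsets N) + 1 ≡⟨ cong (_+ 1) (trans (+-comm M _) (count-+-count-not ⊆s̄∨⊆s (subsets N))) ⟩
  length (subsets N) + 1 ≡⟨ cong (_+ 1) (length-subsets N) ⟩
  2 ^ N + 1 ∎
  where
  open ≡-Reasoning
  M = count (meetsBoth s) (subsets N)
  ⊆s̄ ⊆s ⊆s̄∨⊆s ⊆s̄∧⊆s : Vec Bool N → Bool
  ⊆s̄ X = X ⊆ᵇ (not ∘ s)
  ⊆s X = X ⊆ᵇ s
  ⊆s̄∨⊆s X = ⊆s̄ X ∨ ⊆s X
  ⊆s̄∧⊆s X = ⊆s̄ X ∧ ⊆s X
  only-∅ : count ⊆s̄∧⊆s (subsets N) ≡ 1
  only-∅ = begin
    count ⊆s̄∧⊆s (subsets N)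
      ≡⟨ count-cong _ _ (λ X → ⊆ᵇ-∧ X (not ∘ s) s) (subsets N) ⟩
    count (_⊆ᵇ (λ u → not (s u) ∧ s u)) (subsets N)
      ≡⟨ count-⊆ᵇ (λ u → not (s u) ∧ s u) ⟩
    2 ^ ∣ (λ u → not (s u) ∧ s u) ∣
      ≡⟨ cong (2 ^_) (∣∣-none _ (λ u → ∧-inverseˡ (s u))) ⟩
    1 ∎

2^N+1≤∂+2^∣s̄∣+2^∣s∣ : (G : Graph N) (s : Fin N → Bool) →
  (∀ S → T (meetsBoth s S) → T (isDominatingᵇ G S)) →
  2 ^ N + 1 ≤ ∂ G + 2 ^ ∣ not ∘ s ∣ + 2 ^ ∣ s ∣
2^N+1≤∂+2^∣s̄∣+2^∣s∣ {N} G s meets⇒dom =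
  subst (_≤ ∂ G + 2 ^ ∣ not ∘ s ∣ + 2 ^ ∣ s ∣) (count-meetsBoth s)
    (+-monoˡ-≤ (2 ^ ∣ s ∣) (+-monoˡ-≤ (2 ^ ∣ not ∘ s ∣) (count-mono _ _ meets⇒dom (subsets N))))

lowerHalf : ∀ N → Fin N → Bool
lowerHalf N u = toℕ u <ᵇ ⌊ N /2⌋

∣lowerHalf∣ : ∀ N → ∣ lowerHalf N ∣ ≡ ⌊ N /2⌋
∣lowerHalf∣ N = trans (∣<ᵇ∣ N ⌊ N /2⌋) (m≥n⇒m⊓n≡n (⌊n/2⌋≤n N))

∣upperHalf∣ : ∀ N → ∣ not ∘ lowerHalf N ∣ ≡ ⌈ N /2⌉
∣upperHalf∣ N = +-cancelˡ-≡ ⌊ N /2⌋ _ _ (begin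
  ⌊ N /2⌋ + ∣ not ∘ lowerHalf N ∣     ≡⟨ cong (_+ ∣ not ∘ lowerHalf N ∣) (∣lowerHalf∣ N) ⟨
  ∣ lowerHalf N ∣ + ∣ not ∘ lowerHalf N ∣ ≡⟨ ∣∣-+-∣not∣ (lowerHalf N) ⟩
  N                                     ≡⟨ ⌊n/2⌋+⌈n/2⌉≡n N ⟨
  ⌊ N /2⌋ + ⌈ N /2⌉ ∎)
  where open ≡-Reasoning

balancedBipartite : ∀ N → Graph N
balancedBipartite N = bipartite (lowerHalf N)

balancedBipartite-bound : ∀ N → let H = balancedBipartite N in
  2 ^ N + 2 ^ N + 2 ≤ ∂ H + ∂ (complement H) + 2 ^ (2 + ⌈ N /2⌉)
balancedBipartite-bound N = begin
  2 ^ N + 2 ^ N + 2                          ≡⟨ solve 1 (λ P → P :+ P :+ con 2 := (P :+ con 1) :+ (P :+ con 1)) refl (2 ^ N) ⟩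
  (2 ^ N + 1) + (2 ^ N + 1)                  ≤⟨ +-mono-≤ (bound H (meetsBoth⇒dominates-bipartite s))
                                                          (bound (complement H) (meetsBoth⇒dominates-complement s)) ⟩
  (∂ H + up + low) + (∂ (complement H) + up + low) ≤⟨ +-mono-≤ (+-monoʳ-≤ (∂ H + up) low≤up)
                                                          (+-monoʳ-≤ (∂ (complement H) + up) low≤up) ⟩
  (∂ H + up + up) + (∂ (complement H) + up + up)   ≡⟨ solve 3 (λ h h̄ x → (h :+ x :+ x) :+ (h̄ :+ x :+ x)
                                                          := h :+ h̄ :+ con 2 :* (con 2 :* x)) refl (∂ H) (∂ (complement H)) up ⟩
  ∂ H + ∂ (complement H) + 2 ^ (2 + ⌈ N /2⌉) ∎
  where
  open ≤-Reasoning
  open +-*-Solver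
  s = lowerHalf N
  H = bipartite s
  up = 2 ^ ⌈ N /2⌉
  low = 2 ^ ⌊ N /2⌋
  low≤up : low ≤ up
  low≤up = ^-monoʳ-≤ 2 (⌊n/2⌋≤⌈n/2⌉ N)
  bound : (G : Graph N) → (∀ S → T (meetsBoth s S) → T (isDominatingᵇ G S)) → 2 ^ N + 1 ≤ ∂ G + up + low
  bound G meets⇒dom = subst₂ (λ a b → 2 ^ N + 1 ≤ ∂ G + 2 ^ a + 2 ^ b) (∣upperHalf∣ N) (∣lowerHalf∣ N)
                        (2^N+1≤∂+2^∣s̄∣+2^∣s∣ G s meets⇒dom)

MaximizesDominationSum : Graph N → Set
MaximizesDominationSum {N} G = ∀ (H : Graph N) → ∂ H + ∂ (complement H) ≤ ∂ G + ∂ (complement G)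

2^m<2^n⇒m<n : ∀ {m n} → 2 ^ m < 2 ^ n → m < n
2^m<2^n⇒m<n lt = ≰⇒> (λ n≤m → <⇒≱ lt (^-monoʳ-≤ 2 n≤m))

maximizer-deficit≤ : (G : Graph N) → MaximizesDominationSum G →
  ∀ d → ∂ G + ∂ (complement G) + 2 ^ d ≤ 2 ^ N + 2 ^ N → d ≤ ⌈ N /2⌉ + 1
maximizer-deficit≤ {N} G maximal d deficit = subst (d ≤_) (+-comm 1 ⌈ N /2⌉) (s≤s⁻¹ (2^m<2^n⇒m<n 2^d<))
  where
  X = ∂ G + ∂ (complement G)
  H = balancedBipartite N
  2^d+2≤ : 2 ^ d + 2 ≤ 2 ^ (2 + ⌈ N /2⌉)
  2^d+2≤ = +-cancelˡ-≤ X _ _ (begin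
    X + (2 ^ d + 2)                 ≡⟨ +-assoc X (2 ^ d) 2 ⟨
    X + 2 ^ d + 2                   ≤⟨ +-monoˡ-≤ 2 deficit ⟩
    2 ^ N + 2 ^ N + 2               ≤⟨ balancedBipartite-bound N ⟩
    ∂ H + ∂ (complement H) + 2 ^ (2 + ⌈ N /2⌉) ≤⟨ +-monoˡ-≤ _ (maximal H) ⟩
    X + 2 ^ (2 + ⌈ N /2⌉) ∎)
    where open ≤-Reasoning
  2^d< : 2 ^ d < 2 ^ (2 + ⌈ N /2⌉)
  2^d< = <-≤-trans (m<m+n (2 ^ d) (s≤s z≤n)) 2^d+2≤

maximizer-deg≤ : (G : Graph N) → MaximizesDominationSum G → ∀ v → deg G v ≤ ⌈ N /2⌉ + 1
maximizer-deg≤ {N} G maximal v = maximizer-deficit≤ G maximal (deg G v) (begin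
  ∂ G + ∂ (complement G) + 2 ^ deg G v   ≡⟨ +-assoc (∂ G) _ _ ⟩
  ∂ G + (∂ (complement G) + 2 ^ deg G v) ≤⟨ +-mono-≤ (∂≤2^N G) (∂̄+2^deg≤2^N G v) ⟩
  2 ^ N + 2 ^ N ∎)
  where open ≤-Reasoning

maximizer-deḡ≤ : (G : Graph N) → MaximizesDominationSum G → ∀ v → deg (complement G) v ≤ ⌈ N /2⌉ + 1
maximizer-deḡ≤ {N} G maximal v = maximizer-deficit≤ G maximal (deg (complement G) v) (begin
  ∂ G + ∂ (complement G) + 2 ^ e   ≡⟨ +-assoc (∂ G) _ _ ⟩
  ∂ G + (∂ (complement G) + 2 ^ e) ≡⟨ cong (∂ G +_) (+-comm (∂ (complement G)) _) ⟩
  ∂ G + (2 ^ e + ∂ (complement G)) ≡⟨ +-assoc (∂ G) _ _ ⟨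
  ∂ G + 2 ^ e + ∂ (complement G)   ≤⟨ +-mono-≤ (∂+2^deḡ≤2^N G v) (∂≤2^N (complement G)) ⟩
  2 ^ N + 2 ^ N ∎)
  where
  open ≤-Reasoning
  e = deg (complement G) v

⌊/2⌋∸2≤ : ∀ {n x y} → x + y ≡ n → y ≤ ⌈ suc n /2⌉ + 1 → ⌊ suc n /2⌋ ∸ 2 ≤ x
⌊/2⌋∸2≤ {n} {x} {y} x+y≡n y≤ = m≤n+o⇒m∸n≤o ⌊ suc n /2⌋ 2 (+-cancelʳ-≤ ⌈ suc n /2⌉ _ _ (begin
  ⌊ suc n /2⌋ + ⌈ suc n /2⌉ ≡⟨ ⌊n/2⌋+⌈n/2⌉≡n (suc n) ⟩
  suc n                     ≡⟨ cong suc x+y≡n ⟨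
  suc (x + y)               ≤⟨ s≤s (+-monoʳ-≤ x y≤) ⟩
  suc (x + (⌈ suc n /2⌉ + 1)) ≡⟨ solve 2 (λ x b → con 1 :+ (x :+ (b :+ con 1)) := con 2 :+ x :+ b) refl x ⌈ suc n /2⌉ ⟩
  2 + x + ⌈ suc n /2⌉ ∎))
  where
  open ≤-Reasoning
  open +-*-Solver

k≤δ : ∀ {n k} (G : Graph (suc n)) → (∀ v → k ≤ deg G v) → k ≤ δ G
k≤δ {n} G k≤deg = go (allFin (suc n))
  where
  go : ∀ vs → _ ≤ foldr (λ v m → deg G v ⊓ m) (deg G zero) vs
  go []       = k≤deg zero
  go (v ∷ vs) = ⊓-glb (k≤deg v) (go vs)

Δ≤k : ∀ {n k} (G : Graph n) → (∀ v → deg G v ≤ k) → Δ G ≤ k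
Δ≤k {n} G deg≤k = go (allFin n)
  where
  go : ∀ vs → foldr (λ v m → deg G v ⊔ m) 0 vs ≤ _
  go []       = z≤n
  go (v ∷ vs) = ⊔-lub (deg≤k v) (go vs)

theorem2 : (n : ℕ) (G : Graph (suc n)) →
    (∀ (H : Graph (suc n)) → ∂ H + ∂ (complement H) ≤ ∂ G + ∂ (complement G)) →
    (⌊ suc n /2⌋ ∸ 2 ≤ δ G ⊓ δ (complement G)) × (Δ G ⊔ Δ (complement G) ≤ ⌈ suc n /2⌉ + 1)
theorem2 n G maximal =
  ⊓-glb (k≤δ G λ v → ⌊/2⌋∸2≤ (deg+deḡ≡n G v) (maximizer-deḡ≤ G maximal v))
        (k≤δ (complement G) λ v → ⌊/2⌋∸2≤ (trans (+-comm (deg (complement G) v) (deg G v)) (deg+deḡ≡n G v)) (maximizer-deg≤ G maximal v)) ,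
  ⊔-lub (Δ≤k G (maximizer-deg≤ G maximal)) (Δ≤k (complement G) (maximizer-deḡ≤ G maximal))
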